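{- (1) Let $t$ be a defined term. For any term $t'$, if $\bar t\to_{\lambda_C^- }t'$, then $t'=\bar t_0$ for some term $t_0$ such that $t\to t_0$. (2) For any terms $t,t'$, if $\bar t\to_{cc}t'$, then $t'\to_{cc}^*\bar t_0$ for some term $t_0$ such that $t\to_{cc}t_0$.
   Context: The lambda calculus with constructors ($\lambda_C$). Fix constructors $\{c_1,\dots,c_n\}$ ($n\ge1$). Terms: $t,u::=x\mid tu\mid\lambda x.t\mid c\mid\{\theta\}\cdot t$, case-bindings $\theta=\{d_1\mapsto u_1;\dots;d_k\mapsto u_k\}$ ($k\ge0$, pairwise distinct constructors), $\mathrm{dom}(\theta)=\{d_1,\dots,d_k\}$; terms up to $\alpha$-conversion. $\theta\circ\{d_j\mapsto t_j\}_j=\{d_j\mapsto\{\theta\}\cdot t_j\}_j$. The rules are (AppLam) $(\lambda x.t)u\to t[x:=u]$; (LamApp) $\lambda x.t\,x\to t$ if $x\notin FV(t)$; (CaseCons) $\{\theta\}\cdot c\to t$ if $(c\mapsto t)\in\theta$; (CaseApp) $\{\theta\}\cdot(tu)\to(\{\theta\}\cdot t)u$; (CaseLam) $\{\theta\}\cdot\lambda x.t\to\lambda x.\{\theta\}\cdot t$ if $x\notin FV(\theta)$; (CaseCase) $\{\theta\}\cdot\{\phi\}\cdot t\to\{\theta\circ\phi\}\cdot t$. $\to$ is the contextual closure (also inside case-bindings) of all six rules; $\to_{\lambda_C^- }$ the contextual closure of all rules except CaseCase; $\to_{cc}$ the contextual closure of CaseCase alone; ${}^*$ denotes reflexive transitive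 closure. A match failure is $\{\theta\}\cdot c$ with $c\notin\mathrm{dom}(\theta)$; a term is defined if none of its subterms is a match failure. Case-completion: $\bar x=x$, $\bar c=c$, $\overline{\lambda x.t}=\lambda x.\bar t$, $\overline{tu}=\bar t\,\bar u$, $\overline{\{\theta\}\cdot t}=\{\bar\theta\}\cdot\bar t$, where $\bar\theta=\{c_i\mapsto u'_i\mid1\le i\le n\}$ with $u'_i=\bar u_i$ if $(c_i\mapsto u_i)\in\theta$ and $u'_i=\{\}\cdot c_1$ (empty case-binding applied to $c_1$) if $c_i\notin\mathrm{dom}(\theta)$. -}

module Defs where

-- Terms are represented with de Bruijn indices (so syntactic equality is
-- α-equivalence).
-- A case-binding θ is a vector  Vec (Maybe (Term n)) n : entry c is  just u
-- iff (c ↦ u) ∈ θ, and nothing iff c ∉ dom(θ).  (Pairwise distinctness of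
-- the constructors in θ is thereby automatic.)

open import Data.Nat using (ℕ; zero; suc; _+_; _<ᵇ_; compare; less; equal; greater)
open import Data.Fin using (Fin; zero)
open import Data.Vec using (Vec; []; _∷_; lookup; replicate; map)
open import Data.Maybe using (Maybe; just; nothing)
import Data.Maybe as Maybe
open import Data.Bool using (true; false; if_then_else_)
open import Data.Product using (Σ; _×_; _,_; ∃)
open import Data.Unit using (⊤)
open import Relation.Nullary using (¬_)
open import Relation.Binary.PropositionalEquality using (_≡_; _≢_)
open import Relation.Binary.Construct.Closure.ReflexiveTransitive using (Star)

data Term (n : ℕ) : Set where
  var  : ℕ → Term n
  app  : Term n → Term n → Term n
  lam  : Term n → Term n
  con  : Fin n → Term n
  case : Vec (Maybe (Term n)) n → Term n → Term n

CB : ℕ → Set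
CB n = Vec (Maybe (Term n)) n

private
  variable
    n m : ℕ

shiftVar : ℕ → ℕ → ℕ
shiftVar c x = if x <ᵇ c then x else suc x

mutual
  shift : ℕ → Term n → Term n
  shift c (var x)    = var (shiftVar c x)
  shift c (app t u)  = app (shift c t) (shift c u)
  shift c (lam t)    = lam (shift (suc c) t)
  shift c (con d)    = con d
  shift c (case θ t) = case (shiftCB c θ) (shift c t)

  shiftCB : ℕ → Vec (Maybe (Term n)) m → Vec (Maybe (Term n)) m
  shiftCB c []           = []
  shiftCB c (nothing ∷ θ) = nothing ∷ shiftCB c θ
  shiftCB c (just u ∷ θ)  = just (shift c u) ∷ shiftCB c θ

-- substVar x k u : the result of substituting u for index k in  var x,
-- where indices above k are decremented (the bound variable disappears).
substVar : ℕ → ℕ → Term n → Term n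
substVar x k u with compare x k
... | less _ _    = var x
... | equal _     = u
... | greater _ j = var (k + j)

mutual
  sub : ℕ → Term n → Term n → Term n
  sub k u (var x)    = substVar x k u
  sub k u (app t s)  = app (sub k u t) (sub k u s)
  sub k u (lam t)    = lam (sub (suc k) (shift 0 u) t)
  sub k u (con d)    = con d
  sub k u (case θ t) = case (subCB k u θ) (sub k u t)

  subCB : ℕ → Term n → Vec (Maybe (Term n)) m → Vec (Maybe (Term n)) m
  subCB k u []            = []
  subCB k u (nothing ∷ θ) = nothing ∷ subCB k u θ
  subCB k u (just s ∷ θ)  = just (sub k u s) ∷ subCB k u θ

_∘CB_ : CB n → CB n → CB n
θ ∘CB φ = map (Maybe.map (case θ)) φ

data Rule : Set where
  AppLam LamApp CaseCons CaseApp CaseLam CaseCase : Rule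

data Root {n} : Rule → Term n → Term n → Set where
  appLam   : ∀ t u → Root AppLam (app (lam t) u) (sub 0 u t)
  -- λx. t x → t  with x ∉ FV(t): in de Bruijn, the body is  (shift 0 t) (var 0)
  lamApp   : ∀ t → Root LamApp (lam (app (shift 0 t) (var 0))) t
  caseCons : ∀ θ c t → lookup θ c ≡ just t → Root CaseCons (case θ (con c)) t
  caseApp  : ∀ θ t u → Root CaseApp (case θ (app t u)) (app (case θ t) u)
  -- side condition x ∉ FV(θ) is handled by shifting θ under the binder
  caseLam  : ∀ θ t → Root CaseLam (case θ (lam t)) (lam (case (shiftCB 0 θ) t))
  caseCase : ∀ θ φ t → Root CaseCase (case θ (case φ t)) (case (θ ∘CB φ) t)

mutual
  data Ctx (P : Rule → Set) {n} : Term n → Term n → Set where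
    base  : ∀ {r t t'} → P r → Root r t t' → Ctx P t t'
    appL  : ∀ {t t' u} → Ctx P t t' → Ctx P (app t u) (app t' u)
    appR  : ∀ {t u u'} → Ctx P u u' → Ctx P (app t u) (app t u')
    lamC  : ∀ {t t'} → Ctx P t t' → Ctx P (lam t) (lam t')
    caseT : ∀ {θ t t'} → Ctx P t t' → Ctx P (case θ t) (case θ t')
    caseB : ∀ {θ θ' t} → CtxCB P θ θ' → Ctx P (case θ t) (case θ' t)

  data CtxCB (P : Rule → Set) {n} : ∀ {m} → Vec (Maybe (Term n)) m → Vec (Maybe (Term n)) m → Set where
    here  : ∀ {m u u'} {θ : Vec (Maybe (Term n)) m} → Ctx P u u' → CtxCB P (just u ∷ θ) (just u' ∷ θ)
    there : ∀ {m x} {θ θ' : Vec (Maybe (Term n)) m} → CtxCB P θ θ' → CtxCB P (x ∷ θ) (x ∷ θ')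

_⟶_ : Term n → Term n → Set
_⟶_ = Ctx (λ _ → ⊤)

_⟶⁻_ : Term n → Term n → Set
_⟶⁻_ = Ctx (λ r → r ≢ CaseCase)

_⟶cc_ : Term n → Term n → Set
_⟶cc_ = Ctx (λ r → r ≡ CaseCase)

_⟶cc*_ : Term n → Term n → Set
_⟶cc*_ = Star _⟶cc_

data _⊑_ {n} (s : Term n) : Term n → Set where
  refl⊑ : s ⊑ s
  appL⊑ : ∀ {t u} → s ⊑ t → s ⊑ app t u
  appR⊑ : ∀ {t u} → s ⊑ u → s ⊑ app t u
  lam⊑  : ∀ {t} → s ⊑ t → s ⊑ lam t
  caseT⊑ : ∀ {θ t} → s ⊑ t → s ⊑ case θ t
  caseB⊑ : ∀ {θ t c u} → lookup θ c ≡ just u → s ⊑ u → s ⊑ case θ t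

MatchFailure : Term n → Set
MatchFailure {n} s = Σ (CB n) λ θ → Σ (Fin n) λ c → (s ≡ case θ (con c)) × (lookup θ c ≡ nothing)

Defined : Term n → Set
Defined t = ∀ s → s ⊑ t → ¬ MatchFailure s

-- Case-completion (constructors c₁,…,c_n with n ≥ 1; c₁ = zero)

mutual
  bar : Term (suc n) → Term (suc n)
  bar (var x)    = var x
  bar (con c)    = con c
  bar (lam t)    = lam (bar t)
  bar (app t u)  = app (bar t) (bar u)
  bar (case θ t) = case (barCB θ) (bar t)

  barCB : Vec (Maybe (Term (suc n))) m → Vec (Maybe (Term (suc n))) m
  barCB []            = []
  barCB (nothing ∷ θ) = just (case (replicate _ nothing) (con zero)) ∷ barCB θ
  barCB (just u ∷ θ)  = just (bar u) ∷ barCB θ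

-- Reading the case-completion as an inductive relation, it is preserved by shifting
-- and substitution and reflected by shifting.  Hence every non-CaseCase redex of bar t
-- lies over a redex of t of the same rule: the filler {}·c₁ is a normal form, and a
-- CaseCons redex over a missing branch would be a match failure of t.  A CaseCase step
-- of bar t merges two completed bindings; the result is a completion once each entry
-- {θ}·{}·c₁ is collapsed back to {}·c₁ by a further CaseCase step.
module Submission where

open import Defs
open import Data.Nat using (ℕ; zero; suc; _+_; compare; less; equal; greater)
open import Data.Fin using (zero; suc)
open import Data.Vec using (Vec; []; _∷_; lookup; replicate; map; tail)
open import Data.Vec.Properties using (map-replicate)
open import Data.Maybe using (Maybe; just; nothing)
import Data.Maybe as Maybe
open import Data.Product using (Σ; _×_; _,_)
open import Data.Empty using (⊥-elim)
open import Function using (id)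
open import Relation.Nullary using (¬_)
open import Relation.Binary.PropositionalEquality
  using (_≡_; _≢_; refl; cong; subst)
open import Relation.Binary.Construct.Closure.ReflexiveTransitive using (Star; ε; _◅_; gmap)

shiftCB-replicate-nothing : ∀ {n} c k → shiftCB {n} c (replicate k nothing) ≡ replicate k nothing
shiftCB-replicate-nothing c zero    = refl
shiftCB-replicate-nothing c (suc k) = cong (nothing ∷_) (shiftCB-replicate-nothing c k)

subCB-replicate-nothing : ∀ {n} k (u : Term n) j → subCB k u (replicate j nothing) ≡ replicate j nothing
subCB-replicate-nothing k u zero    = refl
subCB-replicate-nothing k u (suc j) = cong (nothing ∷_) (subCB-replicate-nothing k u j)

mutual
  Ctx-mono : ∀ {P Q : Rule → Set} {n} {t t' : Term n} → (∀ {r} → P r → Q r) → Ctx P t t' → Ctx Q t t'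
  Ctx-mono f (base p r) = base (f p) r
  Ctx-mono f (appL st)  = appL (Ctx-mono f st)
  Ctx-mono f (appR st)  = appR (Ctx-mono f st)
  Ctx-mono f (lamC st)  = lamC (Ctx-mono f st)
  Ctx-mono f (caseT st) = caseT (Ctx-mono f st)
  Ctx-mono f (caseB st) = caseB (CtxCB-mono f st)

  CtxCB-mono : ∀ {P Q : Rule → Set} {n k} {θ θ' : Vec (Maybe (Term n)) k} →
               (∀ {r} → P r → Q r) → CtxCB P θ θ' → CtxCB Q θ θ'
  CtxCB-mono f (here st)  = here (Ctx-mono f st)
  CtxCB-mono f (there st) = there (CtxCB-mono f st)

con-normal : ∀ {P n c} {u : Term n} → ¬ Ctx P (con c) u
con-normal (base _ ())

replicate-nothing-normal : ∀ {P n k} {θ' : Vec (Maybe (Term n)) k} → ¬ CtxCB P (replicate k nothing) θ'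
replicate-nothing-normal {k = suc k} (there st) = replicate-nothing-normal st

Defined-antimono : ∀ {n} {a t : Term n} → (∀ {s} → s ⊑ a → s ⊑ t) → Defined t → Defined a
Defined-antimono embed D s s⊑a = D s (embed s⊑a)

module _ {m : ℕ} where

  private
    Tm : Set
    Tm = Term (suc m)

    Binding : ℕ → Set
    Binding k = Vec (Maybe Tm) k

  emptyMatch : Tm
  emptyMatch = case (replicate (suc m) nothing) (con zero)

  emptyMatch-normal : ∀ {P} {u : Tm} → ¬ Ctx P emptyMatch u
  emptyMatch-normal (base _ (caseCons _ _ _ ()))
  emptyMatch-normal (caseT st) = con-normal st
  emptyMatch-normal (caseB st) = replicate-nothing-normal st

  shift-emptyMatch : ∀ c → shift c emptyMatch ≡ emptyMatch
  shift-emptyMatch c = cong (λ θ → case θ (con zero)) (shiftCB-replicate-nothing c (suc m))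

  sub-emptyMatch : ∀ k (u : Tm) → sub k u emptyMatch ≡ emptyMatch
  sub-emptyMatch k u = cong (λ θ → case θ (con zero)) (subCB-replicate-nothing k u (suc m))

  shiftCB⁻¹-replicate-nothing : ∀ {k} c (ψ : Binding k) → shiftCB c ψ ≡ replicate k nothing → ψ ≡ replicate k nothing
  shiftCB⁻¹-replicate-nothing c []            eq = refl
  shiftCB⁻¹-replicate-nothing c (nothing ∷ ψ) eq =
    cong (nothing ∷_) (shiftCB⁻¹-replicate-nothing c ψ (cong tail eq))
  shiftCB⁻¹-replicate-nothing c (just _ ∷ ψ)  ()

  shift⁻¹-emptyMatch : ∀ c (w : Tm) → shift c w ≡ emptyMatch → w ≡ emptyMatch
  shift⁻¹-emptyMatch c (case ψ (con zero)) eq with shiftCB c ψ in eqψ | eq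
  ... | _ | refl = cong (λ θ → case θ (con zero)) (shiftCB⁻¹-replicate-nothing c ψ eqψ)

  case-emptyMatch⟶cc : (θ : CB (suc m)) → case θ emptyMatch ⟶cc emptyMatch
  case-emptyMatch⟶cc θ =
    subst (λ φ → case θ emptyMatch ⟶cc case φ (con zero))
          (map-replicate (Maybe.map (case θ)) nothing (suc m))
          (base refl (caseCase θ (replicate (suc m) nothing) (con zero)))

  -- The graph of bar.  A filler entry carries an equation rather than the index
  -- emptyMatch itself, so that it still unifies with entries of the form shift c w.
  mutual
    data Completion : Tm → Tm → Set where
      var  : ∀ x → Completion (var x) (var x)
      app  : ∀ {a b x y} → Completion a x → Completion b y → Completion (app a b) (app x y)
      lam  : ∀ {a x} → Completion a x → Completion (lam a) (lam x)
      con  : ∀ c → Completion (con c) (con c)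
      case : ∀ {θ ψ a x} → CompletionCB θ ψ → Completion a x → Completion (case θ a) (case ψ x)

    data CompletionCB : ∀ {k} → Binding k → Binding k → Set where
      []   : CompletionCB [] []
      hole : ∀ {k e} {θ ψ : Binding k} →
             e ≡ emptyMatch → CompletionCB θ ψ → CompletionCB (nothing ∷ θ) (just e ∷ ψ)
      just : ∀ {k u w} {θ ψ : Binding k} →
             Completion u w → CompletionCB θ ψ → CompletionCB (just u ∷ θ) (just w ∷ ψ)

  mutual
    completion : ∀ t → Completion t (bar t)
    completion (var x)    = var x
    completion (app t u)  = app (completion t) (completion u)
    completion (lam t)    = lam (completion t)
    completion (con c)    = con c
    completion (case θ t) = case (completionCB θ) (completion t)

    completionCB : ∀ {k} (θ : Binding k) → CompletionCB θ (barCB θ)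
    completionCB []            = []
    completionCB (nothing ∷ θ) = hole refl (completionCB θ)
    completionCB (just u ∷ θ)  = just (completion u) (completionCB θ)

  mutual
    Completion⇒≡bar : ∀ {t s} → Completion t s → s ≡ bar t
    Completion⇒≡bar (var x)    = refl
    Completion⇒≡bar (app p q)  rewrite Completion⇒≡bar p | Completion⇒≡bar q = refl
    Completion⇒≡bar (lam p)    rewrite Completion⇒≡bar p = refl
    Completion⇒≡bar (con c)    = refl
    Completion⇒≡bar (case P p) rewrite CompletionCB⇒≡barCB P | Completion⇒≡bar p = refl

    CompletionCB⇒≡barCB : ∀ {k} {θ ψ : Binding k} → CompletionCB θ ψ → ψ ≡ barCB θ
    CompletionCB⇒≡barCB []            = refl
    CompletionCB⇒≡barCB (hole refl P) rewrite CompletionCB⇒≡barCB P = refl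
    CompletionCB⇒≡barCB (just p P)    rewrite Completion⇒≡bar p | CompletionCB⇒≡barCB P = refl

  mutual
    Completion-shift : ∀ c {a x} → Completion a x → Completion (shift c a) (shift c x)
    Completion-shift c (var x)    = var (shiftVar c x)
    Completion-shift c (app p q)  = app (Completion-shift c p) (Completion-shift c q)
    Completion-shift c (lam p)    = lam (Completion-shift (suc c) p)
    Completion-shift c (con d)    = con d
    Completion-shift c (case P p) = case (CompletionCB-shift c P) (Completion-shift c p)

    CompletionCB-shift : ∀ c {k} {θ ψ : Binding k} → CompletionCB θ ψ → CompletionCB (shiftCB c θ) (shiftCB c ψ)
    CompletionCB-shift c []            = []
    CompletionCB-shift c (hole refl P) = hole (shift-emptyMatch c) (CompletionCB-shift c P)
    CompletionCB-shift c (just p P)    = just (Completion-shift c p) (CompletionCB-shift c P)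

  Completion-substVar : ∀ x k {b y} → Completion b y → Completion (substVar x k b) (substVar x k y)
  Completion-substVar x k q with compare x k
  ... | less _ _    = var x
  ... | equal _     = q
  ... | greater _ j = var (k + j)

  mutual
    Completion-sub : ∀ k {a x b y} → Completion b y → Completion a x → Completion (sub k b a) (sub k y x)
    Completion-sub k q (var x)    = Completion-substVar x k q
    Completion-sub k q (app p p') = app (Completion-sub k q p) (Completion-sub k q p')
    Completion-sub k q (lam p)    = lam (Completion-sub (suc k) (Completion-shift 0 q) p)
    Completion-sub k q (con d)    = con d
    Completion-sub k q (case P p) = case (CompletionCB-sub k q P) (Completion-sub k q p)

    CompletionCB-sub : ∀ k {b y j} {θ ψ : Binding j} →
                       Completion b y → CompletionCB θ ψ → CompletionCB (subCB k b θ) (subCB k y ψ)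
    CompletionCB-sub k q []            = []
    CompletionCB-sub k q (hole refl P) = hole (sub-emptyMatch k _) (CompletionCB-sub k q P)
    CompletionCB-sub k q (just p P)    = just (Completion-sub k q p) (CompletionCB-sub k q P)

  mutual
    Completion-shift⁻¹ : ∀ c s {a} → Completion a (shift c s) →
                         Σ Tm λ a' → a ≡ shift c a' × Completion a' s
    Completion-shift⁻¹ c (var y)   (var _) = var y , refl , var y
    Completion-shift⁻¹ c (app s u) (app p q)
      with Completion-shift⁻¹ c s p | Completion-shift⁻¹ c u q
    ... | a' , refl , p' | b' , refl , q' = app a' b' , refl , app p' q'
    Completion-shift⁻¹ c (lam s)   (lam p) with Completion-shift⁻¹ (suc c) s p
    ... | a' , refl , p' = lam a' , refl , lam p'
    Completion-shift⁻¹ c (con d)   (con _) = con d , refl , con d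
    Completion-shift⁻¹ c (case ψ s) (case P p)
      with CompletionCB-shift⁻¹ c ψ P | Completion-shift⁻¹ c s p
    ... | θ' , refl , P' | a' , refl , p' = case θ' a' , refl , case P' p'

    CompletionCB-shift⁻¹ : ∀ c {k} (ψ : Binding k) {θ} → CompletionCB θ (shiftCB c ψ) →
                           Σ (Binding k) λ θ' → θ ≡ shiftCB c θ' × CompletionCB θ' ψ
    CompletionCB-shift⁻¹ c []            []           = [] , refl , []
    CompletionCB-shift⁻¹ c (nothing ∷ ψ) ()
    CompletionCB-shift⁻¹ c (just w ∷ ψ)  (hole e P) with CompletionCB-shift⁻¹ c ψ P
    ... | θ' , refl , P' = nothing ∷ θ' , refl , hole (shift⁻¹-emptyMatch c w e) P'
    CompletionCB-shift⁻¹ c (just w ∷ ψ)  (just p P)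
      with Completion-shift⁻¹ c w p | CompletionCB-shift⁻¹ c ψ P
    ... | u' , refl , p' | θ' , refl , P' = just u' ∷ θ' , refl , just p' P'

  Completion-lookup : ∀ {k} {θ ψ : Binding k} c {v u} →
                      CompletionCB θ ψ → lookup θ c ≡ just v → lookup ψ c ≡ just u → Completion v u
  Completion-lookup zero    (just p _) refl refl = p
  Completion-lookup (suc c) (hole _ P) = Completion-lookup c P
  Completion-lookup (suc c) (just _ P) = Completion-lookup c P

  CompletionCB-∘CB : ∀ {θ ψ : CB (suc m)} {k} {φ χ : Binding k} →
                     CompletionCB θ ψ → CompletionCB φ χ →
                     Σ (Binding k) λ ω → Star (CtxCB (_≡ CaseCase)) (map (Maybe.map (case ψ)) χ) ω
                                       × CompletionCB (map (Maybe.map (case θ)) φ) ω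
  CompletionCB-∘CB Θ [] = [] , ε , []
  CompletionCB-∘CB {ψ = ψ} Θ (hole refl Φ) with CompletionCB-∘CB Θ Φ
  ... | ω , steps , Ω =
    just emptyMatch ∷ ω , here (case-emptyMatch⟶cc ψ) ◅ gmap (just emptyMatch ∷_) there steps , hole refl Ω
  CompletionCB-∘CB {ψ = ψ} Θ (just {w = w} p Φ) with CompletionCB-∘CB Θ Φ
  ... | ω , steps , Ω = just (case ψ w) ∷ ω , gmap (just (case ψ w) ∷_) there steps , just (case Θ p) Ω

  module _ {P : Rule → Set} (P⇒≢CaseCase : ∀ {r} → P r → r ≢ CaseCase) where

    reflect-root : ∀ {r t s s'} → P r → Defined t → Completion t s → Root r s s' →
                   Σ Tm λ t₀ → Completion t₀ s' × Ctx P t t₀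
    reflect-root pr D (app (lam p) q) (appLam _ _) = _ , Completion-sub 0 q p , base pr (appLam _ _)
    reflect-root pr D (lam (app p (var 0))) (lamApp s) with Completion-shift⁻¹ 0 s p
    ... | a' , refl , p' = a' , p' , base pr (lamApp a')
    reflect-root pr D (case {θ = θ} P (con c)) (caseCons _ _ _ lk) with lookup θ c in eq
    ... | nothing = ⊥-elim (D _ refl⊑ (θ , c , refl , eq))
    ... | just v  = v , Completion-lookup c P eq lk , base pr (caseCons θ c v eq)
    reflect-root pr D (case P (app p q)) (caseApp _ _ _) = _ , app (case P p) q , base pr (caseApp _ _ _)
    reflect-root pr D (case P (lam p)) (caseLam _ _) =
      _ , lam (case (CompletionCB-shift 0 P) p) , base pr (caseLam _ _)
    reflect-root pr D _ (caseCase _ _ _) = ⊥-elim (P⇒≢CaseCase pr refl)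

    mutual
      reflect-step : ∀ {t s s'} → Defined t → Completion t s → Ctx P s s' →
                     Σ Tm λ t₀ → Completion t₀ s' × Ctx P t t₀
      reflect-step D p (base pr r) = reflect-root pr D p r
      reflect-step D (app p q) (appL st) with reflect-step (Defined-antimono appL⊑ D) p st
      ... | _ , p₀ , st₀ = _ , app p₀ q , appL st₀
      reflect-step D (app p q) (appR st) with reflect-step (Defined-antimono appR⊑ D) q st
      ... | _ , q₀ , st₀ = _ , app p q₀ , appR st₀
      reflect-step D (lam p) (lamC st) with reflect-step (Defined-antimono lam⊑ D) p st
      ... | _ , p₀ , st₀ = _ , lam p₀ , lamC st₀
      reflect-step D (case P p) (caseT st) with reflect-step (Defined-antimono caseT⊑ D) p st
      ... | _ , p₀ , st₀ = _ , case P p₀ , caseT st₀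
      reflect-step D (case P p) (caseB st)
        with reflect-stepCB (λ _ lk → Defined-antimono (caseB⊑ lk) D) P st
      ... | _ , P₀ , st₀ = _ , case P₀ p , caseB st₀

      reflect-stepCB : ∀ {k} {θ ψ ψ' : Binding k} → (∀ c {u} → lookup θ c ≡ just u → Defined u) →
                       CompletionCB θ ψ → CtxCB P ψ ψ' →
                       Σ (Binding k) λ θ₀ → CompletionCB θ₀ ψ' × CtxCB P θ θ₀
      reflect-stepCB D (hole refl P) (here st) = ⊥-elim (emptyMatch-normal st)
      reflect-stepCB D (just p P) (here st) with reflect-step (D zero refl) p st
      ... | _ , p₀ , st₀ = _ , just p₀ P , here st₀
      reflect-stepCB D (hole e P) (there st) with reflect-stepCB (λ c → D (suc c)) P st
      ... | _ , P₀ , st₀ = _ , hole e P₀ , there st₀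
      reflect-stepCB D (just p P) (there st) with reflect-stepCB (λ c → D (suc c)) P st
      ... | _ , P₀ , st₀ = _ , just p P₀ , there st₀

  mutual
    reflect-cc-step : ∀ {t s s'} → Completion t s → s ⟶cc s' →
                      Σ Tm λ t₀ → Σ Tm λ s₀ → s' ⟶cc* s₀ × Completion t₀ s₀ × t ⟶cc t₀
    reflect-cc-step (case Θ (case {a = a} {x = x} Φ p)) (base refl (caseCase _ _ _))
      with CompletionCB-∘CB Θ Φ
    ... | ω , steps , Ω =
      _ , case ω x , gmap (λ χ → case χ x) caseB steps , case Ω p , base refl (caseCase _ _ a)
    reflect-cc-step (app p q) (appL st) with reflect-cc-step p st
    ... | _ , _ , steps , p₀ , st₀ = _ , _ , gmap (λ z → app z _) appL steps , app p₀ q , appL st₀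
    reflect-cc-step (app p q) (appR st) with reflect-cc-step q st
    ... | _ , _ , steps , q₀ , st₀ = _ , _ , gmap (app _) appR steps , app p q₀ , appR st₀
    reflect-cc-step (lam p) (lamC st) with reflect-cc-step p st
    ... | _ , _ , steps , p₀ , st₀ = _ , _ , gmap lam lamC steps , lam p₀ , lamC st₀
    reflect-cc-step (case P p) (caseT st) with reflect-cc-step p st
    ... | _ , _ , steps , p₀ , st₀ = _ , _ , gmap (case _) caseT steps , case P p₀ , caseT st₀
    reflect-cc-step (case P p) (caseB st) with reflect-cc-stepCB P st
    ... | _ , _ , steps , P₀ , st₀ = _ , _ , gmap (λ χ → case χ _) caseB steps , case P₀ p , caseB st₀

    reflect-cc-stepCB : ∀ {k} {θ ψ ψ' : Binding k} → CompletionCB θ ψ → CtxCB (_≡ CaseCase) ψ ψ' →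
                        Σ (Binding k) λ θ₀ → Σ (Binding k) λ ψ₀ →
                          Star (CtxCB (_≡ CaseCase)) ψ' ψ₀ × CompletionCB θ₀ ψ₀ × CtxCB (_≡ CaseCase) θ θ₀
    reflect-cc-stepCB (hole refl P) (here st) = ⊥-elim (emptyMatch-normal st)
    reflect-cc-stepCB (just p P) (here st) with reflect-cc-step p st
    ... | _ , _ , steps , p₀ , st₀ = _ , _ , gmap (λ z → just z ∷ _) here steps , just p₀ P , here st₀
    reflect-cc-stepCB (hole e P) (there st) with reflect-cc-stepCB P st
    ... | _ , _ , steps , P₀ , st₀ = _ , _ , gmap (_ ∷_) there steps , hole e P₀ , there st₀
    reflect-cc-stepCB (just p P) (there st) with reflect-cc-stepCB P st
    ... | _ , _ , steps , P₀ , st₀ = _ , _ , gmap (_ ∷_) there steps , just p P₀ , there st₀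

lemma5 : ∀ {m : ℕ}
    → (∀ (t t' : Term (suc m)) → Defined t → bar t ⟶⁻ t'
    → Σ (Term (suc m)) λ t₀ → (t' ≡ bar t₀) × (t ⟶ t₀))
    × (∀ (t t' : Term (suc m)) → bar t ⟶cc t'
    → Σ (Term (suc m)) λ t₀ → (t' ⟶cc* bar t₀) × (t ⟶cc t₀))
lemma5 =
    (λ t t' D st →
      let t₀ , p₀ , st₀ = reflect-step id D (completion t) st
      in  t₀ , Completion⇒≡bar p₀ , Ctx-mono _ st₀)
  , (λ t t' st →
      let t₀ , _ , steps , p₀ , st₀ = reflect-cc-step (completion t) st
      in  t₀ , subst (t' ⟶cc*_) (Completion⇒≡bar p₀) steps , st₀)
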